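{- Let $\mathbf A=(A,\le,0,1)$ be a bounded MLUB-complete poset and $\mathbf T=(T,R)$ a time frame with $R$ serial. Then $${}_{\mathbf T}P_{\mathbf A}={}_{\mathbf T}H_{\mathbf A^{op}}={}_{\mathbf T^{op}}F_{\mathbf A}={}_{\mathbf T^{op}}G_{\mathbf A^{op}}.$$ Moreover, if $\mathbf A'=(A',\le')$ is a poset and $f:\mathbf A\to\mathbf A'$ is an isomorphism of posets, then $(\mathcal P_+f)^T\circ{}_{\mathbf T}X_{\mathbf A}={}_{\mathbf T}X_{\mathbf A'}\circ\mathcal P_+(f^T)$ for every $X\in\{P,F,H,G\}$.
   Context: For a poset and $X\subseteq A$: $L(X)$, $U(X)$ the sets of lower/upper bounds, $\operatorname{Max}X,\operatorname{Min}X$ the maximal/minimal elements. MLUB-complete: for every nonempty $M$, every upper bound of $M$ lies above a minimal upper bound and every lower bound below a maximal lower bound. $\mathcal P_+(X)$ = nonempty subsets. A time frame $\mathbf T=(T,R)$: $T\ne\emptyset$, $R\subseteq T^2$; serial: each $s$ has $r,t$ with $rRs$, $sRt$. $\mathbf A^{op}=(A,\ge)$ is the dual poset, $\mathbf T^{op}=(T,R^{ -1})$ where $sR^{ -1}t$ iff $tRs$. For a bounded MLUB-complete poset $\mathbf A$ and time frame $\mathbf T$ with serial relation, the induced tense operators ${}_{\mathbf T}P_{\mathbf A},{}_{\mathbf T}F_{\mathbf A},{}_{\mathbf T}H_{\mathbf A},{}_{\mathbf T}G_{\mathbf A}:\mathcal P_+(A^T)\to(\mathcal P_+A)^T$ are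 ${}_{\mathbf T}P_{\mathbf A}(B)(s)=\operatorname{Min}U(\{q(t)\mid q\in B,tRs\})$, ${}_{\mathbf T}F_{\mathbf A}(B)(s)=\operatorname{Min}U(\{q(t)\mid q\in B,sRt\})$, ${}_{\mathbf T}H_{\mathbf A}(B)(s)=\operatorname{Max}L(\{q(t)\mid q\in B,tRs\})$, ${}_{\mathbf T}G_{\mathbf A}(B)(s)=\operatorname{Max}L(\{q(t)\mid q\in B,sRt\})$, with $L,U,\operatorname{Max},\operatorname{Min}$ computed in $\mathbf A$. For $f:A\to A'$: $\mathcal P_+(f^T):\mathcal P_+(A^T)\to\mathcal P_+(A'^T)$, $B\mapsto\{f\circ b\mid b\in B\}$, and $(\mathcal P_+f)^T:(\mathcal P_+A)^T\to(\mathcal P_+A')^T$, $Z\mapsto(t\mapsto f[Z(t)])$. -}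

module Defs where

open import Level using (Level)
open import Data.Product using (Σ; ∃; ∃-syntax; _×_; _,_)
open import Relation.Binary.Core using (Rel)
open import Relation.Binary.PropositionalEquality using (_≡_)
open import Relation.Unary using (Pred; Satisfiable)
open import Function using (flip)

module _ {a : Level} {A : Set a} (_≤_ : Rel A a) where

  U : Pred A a → Pred A a
  U M x = ∀ y → M y → y ≤ x

  L : Pred A a → Pred A a
  L M x = ∀ y → M y → x ≤ y

  Min : Pred A a → Pred A a
  Min M x = M x × (∀ y → M y → y ≤ x → y ≡ x)

  Max : Pred A a → Pred A a
  Max M x = M x × (∀ y → M y → x ≤ y → y ≡ x)

  Bounded : Set a
  Bounded = Σ A λ z → Σ A λ o → ∀ x → (z ≤ x) × (x ≤ o)

  MLUBComplete : Set _
  MLUBComplete = ∀ (M : Pred A a) → Satisfiable M →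
      (∀ u → U M u → ∃[ m ] (Min (U M) m × m ≤ u))
    × (∀ l → L M l → ∃[ m ] (Max (L M) m × l ≤ m))

Serial : ∀ {a} {T : Set a} → Rel T a → Set a
Serial {T = T} R = ∀ s → (∃[ r ] R r s) × (∃[ t ] R s t)

module _ {a : Level} {A : Set a} {T : Set a} where

  pastVals : Rel T a → Pred (T → A) a → T → Pred A a
  pastVals R B s x = ∃[ q ] ∃[ t ] (B q × R t s × q t ≡ x)

  futVals : Rel T a → Pred (T → A) a → T → Pred A a
  futVals R B s x = ∃[ q ] ∃[ t ] (B q × R s t × q t ≡ x)

  -- the induced tense operators  _T X_A  (order first, then time relation)
  Pop Fop Hop Gop : Rel A a → Rel T a → Pred (T → A) a → T → Pred A a
  Pop _≤_ R B s = Min _≤_ (U _≤_ (pastVals R B s))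
  Fop _≤_ R B s = Min _≤_ (U _≤_ (futVals R B s))
  Hop _≤_ R B s = Max _≤_ (L _≤_ (pastVals R B s))
  Gop _≤_ R B s = Max _≤_ (L _≤_ (futVals R B s))

data TenseOp : Set where
  P F H G : TenseOp

op : ∀ {a} {A T : Set a} → TenseOp → Rel A a → Rel T a → Pred (T → A) a → T → Pred A a
op P = Pop
op F = Fop
op H = Hop
op G = Gop

module _ {a : Level} {A A' T : Set a} (f : A → A') where

  -- P_+(f^T) : B ↦ { f ∘ b | b ∈ B }  (function equality taken pointwise)
  liftFunSet : Pred (T → A) a → Pred (T → A') a
  liftFunSet B q' = ∃[ b ] (B b × (∀ t → f (b t) ≡ q' t))

  -- (P_+ f)^T : Z ↦ (t ↦ f[Z(t)])
  imageFam : (T → Pred A a) → T → Pred A' a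
  imageFam Z t y = ∃[ x ] (Z t x × f x ≡ y)

-- All four operators of the first part unfold to literally the same predicate:
-- a maximal lower bound for the reversed order is a minimal upper bound, and
-- looking forward along R⁻¹ is looking backward along R. For the second part,
-- a bijective order embedding f maps the upper bounds of a set V exactly onto
-- the upper bounds of f[V], and minimal elements onto minimal elements, and the values of
-- f ∘ q are the f-images of the values of q. F, H and G are then P for the
-- reversed relation and/or the reversed orders.
module Submission where

open import Defs
open import Data.Product using (_×_; _,_; ∃-syntax)
open import Relation.Binary.Core using (Rel)
open import Relation.Binary.Structures using (IsPartialOrder)
open import Relation.Binary.PropositionalEquality using (_≡_; refl; cong)
open import Relation.Unary using (Pred; Satisfiable; _≐_)
open import Relation.Unary.Properties using (≐-refl; ≐-sym; ≐-trans)
open import Function using (flip; _⇔_; Equivalence)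
open import Function.Definitions using (Injective; StrictlySurjective; Bijective)
open import Function.Consequences.Propositional using (surjective⇒strictlySurjective)
open import Level using (Level)

Image : ∀ {a} {A A' : Set a} → (A → A') → Pred A a → Pred A' a
Image f M y = ∃[ x ] (M x × f x ≡ y)

module _ {a : Level} {A : Set a} (_≤_ : Rel A a) {M N : Pred A a} where

  U-resp-≐ : M ≐ N → U _≤_ M ≐ U _≤_ N
  U-resp-≐ (M⊆N , N⊆M) =
    (λ uM y ny → uM y (N⊆M ny)) , (λ uN y my → uN y (M⊆N my))

  Min-resp-≐ : M ≐ N → Min _≤_ M ≐ Min _≤_ N
  Min-resp-≐ (M⊆N , N⊆M) =
      (λ (mx , minimal) → M⊆N mx , λ y ny → minimal y (N⊆M ny))
    , (λ (nx , minimal) → N⊆M nx , λ y my → minimal y (M⊆N my))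

module _ {a : Level} {A A' : Set a} {_≤_ : Rel A a} {_≤'_ : Rel A' a} {f : A → A'}
         (f-embedding : ∀ x y → (x ≤ y) ⇔ (f x ≤' f y)) where

  private
    monotone : ∀ {x y} → x ≤ y → f x ≤' f y
    monotone = Equivalence.to (f-embedding _ _)

    reflecting : ∀ {x y} → f x ≤' f y → x ≤ y
    reflecting = Equivalence.from (f-embedding _ _)

  U-image-reflect : ∀ (M : Pred A a) x → U _≤'_ (Image f M) (f x) → U _≤_ M x
  U-image-reflect M x u y my = reflecting (u (f y) (y , my , refl))

  image-U : StrictlySurjective _≡_ f →
            ∀ (M : Pred A a) → Image f (U _≤_ M) ≐ U _≤'_ (Image f M)
  image-U f-surjective M = image⊆U , U⊆image
    where
    image⊆U : ∀ {y} → Image f (U _≤_ M) y → U _≤'_ (Image f M) y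
    image⊆U (x , ux , refl) _ (x' , mx' , refl) = monotone (ux x' mx')

    U⊆image : ∀ {y} → U _≤'_ (Image f M) y → Image f (U _≤_ M) y
    U⊆image {y} u with f-surjective y
    ... | x , refl = x , U-image-reflect M x u , refl

  image-Min : Injective _≡_ _≡_ f →
              ∀ (M : Pred A a) → Image f (Min _≤_ M) ≐ Min _≤'_ (Image f M)
  image-Min f-injective M = image⊆Min , Min⊆image
    where
    image⊆Min : ∀ {y} → Image f (Min _≤_ M) y → Min _≤'_ (Image f M) y
    image⊆Min (x , (mx , minimal) , refl) =
      (x , mx , refl) ,
      λ { _ (x' , mx' , refl) fx'≤fx → cong f (minimal x' mx' (reflecting fx'≤fx)) }

    Min⊆image : ∀ {y} → Min _≤'_ (Image f M) y → Image f (Min _≤_ M) y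
    Min⊆image ((x , mx , refl) , minimal) =
      x , (mx , λ x' mx' x'≤x → f-injective (minimal (f x') (x' , mx' , refl) (monotone x'≤x)))
        , refl

  image-Min-U : Bijective _≡_ _≡_ f →
                ∀ (M : Pred A a) → Image f (Min _≤_ (U _≤_ M)) ≐ Min _≤'_ (U _≤'_ (Image f M))
  image-Min-U (f-injective , f-surjective) M =
    ≐-trans (image-Min f-injective (U _≤_ M))
            (Min-resp-≐ _≤'_ (image-U (surjective⇒strictlySurjective f-surjective) M))

module _ {a : Level} {A A' T : Set a} (f : A → A') (R : Rel T a) (B : Pred (T → A) a) (s : T) where

  pastVals-liftFunSet : pastVals R (liftFunSet f B) s ≐ Image f (pastVals R B s)
  pastVals-liftFunSet =
      (λ { (_ , t , (q , bq , fq≗q') , rts , refl) → q t , (q , t , bq , rts , refl) , fq≗q' t })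
    , (λ { (_ , (q , t , bq , rts , refl) , refl) →
             (λ t → f (q t)) , t , (q , bq , λ _ → refl) , rts , refl })

image-Pop : ∀ {a} {A A' T : Set a} {_≤_ : Rel A a} {_≤'_ : Rel A' a} {f : A → A'} →
            (∀ x y → (x ≤ y) ⇔ (f x ≤' f y)) → Bijective _≡_ _≡_ f →
            ∀ (R : Rel T a) (B : Pred (T → A) a) s →
            imageFam f (Pop _≤_ R B) s ≐ Pop _≤'_ R (liftFunSet f B) s
image-Pop {_≤'_ = _≤'_} {f} f-embedding f-bijective R B s =
  ≐-trans (image-Min-U f-embedding f-bijective (pastVals R B s))
          (Min-resp-≐ _≤'_ (U-resp-≐ _≤'_ (≐-sym (pastVals-liftFunSet f R B s))))

theorem3p4 : ∀ {a} {A : Set a} {_≤_ : Rel A a}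
    → IsPartialOrder _≡_ _≤_ → Bounded _≤_ → MLUBComplete _≤_
    → {T : Set a} (R : Rel T a) → Serial R
    → (∀ (B : Pred (T → A) a) → Satisfiable B → ∀ s →
          (Pop _≤_ R B s ≐ Hop (flip _≤_) R B s)
        × (Pop _≤_ R B s ≐ Fop _≤_ (flip R) B s)
        × (Pop _≤_ R B s ≐ Gop (flip _≤_) (flip R) B s))
    × (∀ {A' : Set a} {_≤'_ : Rel A' a} → IsPartialOrder _≡_ _≤'_
        → (f : A → A') → Bijective _≡_ _≡_ f
        → (∀ x y → (x ≤ y) ⇔ (f x ≤' f y))
        → ∀ (X : TenseOp) (B : Pred (T → A) a) → Satisfiable B → ∀ s →
            imageFam f (op X _≤_ R B) s ≐ op X _≤'_ R (liftFunSet f B) s)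
theorem3p4 _ _ _ R _ =
    (λ _ _ _ → ≐-refl , ≐-refl , ≐-refl)
  , λ _ _ f-bijective f-embedding → λ where
      P B _ s → image-Pop f-embedding f-bijective R B s
      F B _ s → image-Pop f-embedding f-bijective (flip R) B s
      H B _ s → image-Pop (λ x y → f-embedding y x) f-bijective R B s
      G B _ s → image-Pop (λ x y → f-embedding y x) f-bijective (flip R) B s
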